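{- Let $n \geq 2$ be an integer, $\phi$ Euler's totient function, and $S_2(n) = n\prod_{p \mid n}\left(1 - \frac{2}{p}\right)$. Then $S_2(n) = \phi(n) - 1$ if and only if $n$ is prime.
   Context: $S_2$ is Schemmel's totient function; the product is over the distinct primes dividing $n$. In the paper this is phrased as: $n \in D_1$ iff $n$ is prime, where $D_M$ denotes the set of integers $n\ge 2$ with $M S_2(n) = \phi(n)-1$. -}

module Defs where

open import Data.Nat using (ℕ; zero; suc; _≤_; NonZero)
open import Data.Nat.GCD using (gcd)
open import Data.Nat.Divisibility using (_∣?_)
open import Data.Nat.Primality using (prime?)
open import Data.List using (List; []; _∷_; length; filter; upTo; map; foldr)
open import Data.Integer using (ℤ; +_)
open import Data.Rational using (ℚ; _*_; _-_; _/_; 1ℚ)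
open import Relation.Nullary.Decidable using (_×-dec_)
open import Data.Nat using (_≟_)

range1 : ℕ → List ℕ
range1 n = map suc (upTo n)

φ : ℕ → ℕ
φ n = length (filter (λ k → gcd k n ≟ 1) (range1 n))

-- the distinct primes dividing n (for n ≥ 1 all of them lie in [1,n])
primeDivisors : ℕ → List ℕ
primeDivisors n = filter (λ p → prime? p ×-dec (p ∣? n)) (range1 n)

-- the factor (1 - 2/p), for p ≥ 1 (p = 0 never occurs in primeDivisors)
factor : ℕ → ℚ
factor zero    = 1ℚ
factor (suc q) = 1ℚ - ((+ 2) / suc q)

S₂ : ℕ → ℚ
S₂ n = ((+ n) / 1) * foldr (λ p acc → factor p * acc) 1ℚ (primeDivisors n)

-- S₂ and φ are both built prime by prime: for p prime and m ≥ 1,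
--   φ (p m) = p φ m  and  S₂ (p m) = p S₂ m            when p ∣ m,
--   φ (p m) = (p - 1) φ m  and  S₂ (p m) = (p - 2) S₂ m  when p ∤ m.
-- So S₂ n is a natural number, and the gap g n = φ n - S₂ n obeys g 1 = 0,
-- g (p m) = p g m when p ∣ m and g (p m) = (p - 2) g m + φ m when p ∤ m.
-- Hence g p = 1 for every prime p.  For m ≥ 2, g (p m) = 1 is impossible:
-- p g m = 1 fails as p ≥ 2, and (p - 2) g m + φ m = 1 forces φ m = 1, i.e.
-- m = 2, whence g 2 = 1 forces p = 2, contradicting p ∤ m.
module Submission where

open import Defs
open import Algebra.Bundles using (CommutativeMonoid)
open import Data.List using ([]; _∷_; foldr; filter; upTo; map; _∷ʳ_)
open import Data.List.Properties using (upTo-∷ʳ; map-++; foldr-∷ʳ)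
open import Data.List.Relation.Unary.All using (All; []; _∷_)
open import Data.Nat as ℕ using (ℕ; zero; suc; _+_; _*_; _∸_; _≤_; _<_; z≤n; s≤s; s≤s⁻¹; _≟_; >-nonZero; nonTrivial⇒n>1)
open import Data.Nat.Properties
open import Data.Nat.GCD using (gcd)
open import Data.Nat.Coprimality using (Coprime; coprime?; coprime-+; coprime-divisor; coprime⇒gcd≡1; gcd≡1⇒coprime; 1-coprimeTo)
import Data.Nat.Coprimality as Coprime
open import Data.Nat.Divisibility using (_∣_; _∣?_; ∣-refl; ∣-trans; ∣⇒≤; ∣1⇒≡1; 0∣⇒≡0; m∣m*n; ∣n⇒∣m*n; ∣m+n∣m⇒∣n; ∣m∣n⇒∣m+n)
open import Data.Nat.ListAction using (product)
open import Data.Nat.Primality using (Prime; prime?; prime[2]; ¬prime[1]; prime⇒irreducible; prime⇒nonTrivial; euclidsLemma; productOfPrimes≥1)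
open import Data.Nat.Primality.Factorisation using (PrimeFactorisation; factorise)
open import Data.Integer as ℤ using (+_)
open import Data.Integer.Properties using (pos-*; +-injective)
import Data.Integer.Properties as ℤ
open import Data.Integer.Tactic.RingSolver using (solve-∀)
open import Data.Product using (∃-syntax; _,_; proj₂)
open import Data.Rational using (ℚ; _/_; _-_; -_; toℚᵘ; fromℚᵘ; 1ℚ)
import Data.Rational as ℚ
open import Data.Rational.Properties using (toℚᵘ-injective; fromℚᵘ-injective; toℚᵘ-fromℚᵘ; toℚᵘ-homo-*; toℚᵘ-homo-+; toℚᵘ-homo‿-)
import Data.Rational.Properties as ℚ
open import Data.Rational.Unnormalised as ℚᵘ using (ℚᵘ; mkℚᵘ; *≡*)
open import Data.Rational.Unnormalised.Properties using (≃-refl; ≃-sym; ≃-trans; *-cong; +-cong; -‿cong; module ≃-Reasoning)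
open import Algebra.Properties.CommutativeSemigroup (CommutativeMonoid.commutativeSemigroup ℚ.*-1-commutativeMonoid) using () renaming (interchange to ℚ-*-interchange)
open import Data.Empty using (⊥-elim)
open import Data.Sum using (inj₁; inj₂)
open import Function using (_∘_; _⇔_; mk⇔)
open import Function.Properties.Equivalence using () renaming (trans to ⇔-trans)
open import Relation.Nullary using (Dec; yes; no; ¬_; contradiction)
open import Relation.Nullary.Decidable using (_×-dec_)
open import Relation.Unary using (Pred; Decidable)
open import Relation.Binary.PropositionalEquality using (_≡_; _≢_; refl; sym; trans; cong; cong₂; subst; subst₂; module ≡-Reasoning)

-- Finite products over 1, …, N in a commutative monoid

range1-suc : ∀ N → range1 (suc N) ≡ range1 N ∷ʳ suc N
range1-suc N = trans (cong (map suc) (sym (upTo-∷ʳ N))) (map-++ suc (upTo N) (N ∷ []))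

module RangeFold {c ℓ} (M : CommutativeMonoid c ℓ) where

  open CommutativeMonoid M hiding (refl; sym; trans)
  open CommutativeMonoid M using () renaming (refl to ≈-refl; sym to ≈-sym; trans to ≈-trans)
  open import Relation.Binary.Reasoning.Setoid setoid
  open import Algebra.Properties.CommutativeSemigroup commutativeSemigroup using (interchange; x∙yz≈y∙xz)

  fold : ℕ → (ℕ → Carrier) → Carrier
  fold zero    f = ε
  fold (suc N) f = fold N f ∙ f (suc N)

  -- Matching on Dec (rather than using `if does`) keeps `select (P? k) x`
  -- from unfolding, so that `with P? k` can abstract over it.
  select : ∀ {p} {P : Set p} → Dec P → Carrier → Carrier
  select (yes _) x = x
  select (no _)  _ = ε

  select-cong : ∀ {p q} {P : Set p} {Q : Set q} {x} → (P → Q) → (Q → P) → (P? : Dec P) (Q? : Dec Q) →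
                select P? x ≈ select Q? x
  select-cong to from (yes _)  (yes _)  = ≈-refl
  select-cong to from (yes p)  (no ¬q)  = contradiction (to p) ¬q
  select-cong to from (no ¬p)  (yes q)  = contradiction (from q) ¬p
  select-cong to from (no _)   (no _)   = ≈-refl

  mask : ∀ {p} {P : Pred ℕ p} → Decidable P → (ℕ → Carrier) → ℕ → Carrier
  mask P? f k = select (P? k) (f k)

  foldr-seed : ∀ (f : ℕ → Carrier) x xs → foldr (λ k acc → f k ∙ acc) x xs ≈ foldr (λ k acc → f k ∙ acc) ε xs ∙ x
  foldr-seed f x []       = ≈-sym (identityˡ x)
  foldr-seed f x (k ∷ xs) = ≈-trans (∙-congˡ (foldr-seed f x xs)) (≈-sym (assoc (f k) _ x))

  foldr-range1 : ∀ f N → foldr (λ k acc → f k ∙ acc) ε (range1 N) ≈ fold N f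
  foldr-range1 f zero    = ≈-refl
  foldr-range1 f (suc N) = begin
    foldr (λ k acc → f k ∙ acc) ε (range1 (suc N))     ≡⟨ cong (foldr _ ε) (range1-suc N) ⟩
    foldr (λ k acc → f k ∙ acc) ε (range1 N ∷ʳ suc N)  ≡⟨ foldr-∷ʳ _ ε (suc N) (range1 N) ⟩
    foldr (λ k acc → f k ∙ acc) (f (suc N) ∙ ε) (range1 N) ≈⟨ foldr-seed f _ (range1 N) ⟩
    foldr (λ k acc → f k ∙ acc) ε (range1 N) ∙ (f (suc N) ∙ ε) ≈⟨ ∙-cong (foldr-range1 f N) (identityʳ _) ⟩
    fold N f ∙ f (suc N) ∎

  foldr-filter : ∀ {p} {P : Pred ℕ p} (P? : Decidable P) f xs →
    foldr (λ k acc → f k ∙ acc) ε (filter P? xs) ≈ foldr (λ k acc → mask P? f k ∙ acc) ε xs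
  foldr-filter P? f []       = ≈-refl
  foldr-filter P? f (k ∷ xs) with P? k
  ... | yes _ = ∙-congˡ (foldr-filter P? f xs)
  ... | no  _ = ≈-trans (foldr-filter P? f xs) (≈-sym (identityˡ _))

  fold-cong : ∀ N {f g} → (∀ k → 1 ≤ k → k ≤ N → f k ≈ g k) → fold N f ≈ fold N g
  fold-cong zero    f≈g = ≈-refl
  fold-cong (suc N) f≈g = ∙-cong (fold-cong N λ k 1≤k k≤N → f≈g k 1≤k (m≤n⇒m≤1+n k≤N)) (f≈g (suc N) (s≤s z≤n) ≤-refl)

  fold-ε : ∀ N {f} → (∀ k → 1 ≤ k → k ≤ N → f k ≈ ε) → fold N f ≈ ε
  fold-ε zero    f≈ε = ≈-refl
  fold-ε (suc N) f≈ε = ≈-trans (∙-cong (fold-ε N λ k 1≤k k≤N → f≈ε k 1≤k (m≤n⇒m≤1+n k≤N)) (f≈ε (suc N) (s≤s z≤n) ≤-refl)) (identityˡ ε)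

  fold-+ : ∀ N M f → fold (N + M) f ≈ fold N f ∙ fold M (λ k → f (N + k))
  fold-+ N zero    f = subst (λ t → fold t f ≈ fold N f ∙ ε) (sym (+-identityʳ N)) (≈-sym (identityʳ _))
  fold-+ N (suc M) f = begin
    fold (N + suc M) f                               ≡⟨ cong (λ t → fold t f) (+-suc N M) ⟩
    fold (N + M) f ∙ f (suc (N + M))                 ≈⟨ ∙-cong (fold-+ N M f) (reflexive (cong f (sym (+-suc N M)))) ⟩
    (fold N f ∙ fold M (λ k → f (N + k))) ∙ f (N + suc M) ≈⟨ assoc _ _ _ ⟩
    fold N f ∙ fold (suc M) (λ k → f (N + k))        ∎

  fold-∙ : ∀ N f g → fold N (λ k → f k ∙ g k) ≈ fold N f ∙ fold N g
  fold-∙ zero    f g = ≈-sym (identityˡ ε)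
  fold-∙ (suc N) f g = ≈-trans (∙-congʳ (fold-∙ N f g)) (interchange _ _ _ _)

  fold-stable : ∀ N d f → (∀ k → N < k → f k ≈ ε) → fold (N + d) f ≈ fold N f
  fold-stable N d f f≈ε = begin
    fold (N + d) f                        ≈⟨ fold-+ N d f ⟩
    fold N f ∙ fold d (λ k → f (N + k))   ≈⟨ ∙-congˡ (fold-ε d λ k 1≤k _ → f≈ε (N + k) (m<m+n N 1≤k)) ⟩
    fold N f ∙ ε                          ≈⟨ identityʳ _ ⟩
    fold N f ∎

  fold-multiples : ∀ q M f → fold (suc q * M) (mask (suc q ∣?_) f) ≈ fold M (λ j → f (suc q * j))
  fold-multiples q zero    f = reflexive (cong (λ t → fold t (mask (suc q ∣?_) f)) (*-zeroʳ q))
  fold-multiples q (suc M) f = begin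
    fold (p * suc M) g                               ≡⟨ cong (λ t → fold t g) (trans (*-suc p M) (+-comm p (p * M))) ⟩
    fold (p * M + suc q) g                           ≈⟨ fold-+ (p * M) (suc q) g ⟩
    fold (p * M) g ∙ (fold q (λ i → g (p * M + i)) ∙ g (p * M + p)) ≈⟨ ∙-cong (fold-multiples q M f) (∙-cong (fold-ε q off-multiple) (reflexive last)) ⟩
    fold M (λ j → f (p * j)) ∙ (ε ∙ f (p * suc M))   ≈⟨ ∙-congˡ (identityˡ _) ⟩
    fold (suc M) (λ j → f (p * j))                   ∎
    where
    p : ℕ
    p = suc q
    g : ℕ → Carrier
    g = mask (p ∣?_) f
    pM+p≡p[1+M] : p * M + p ≡ p * suc M
    pM+p≡p[1+M] = trans (+-comm (p * M) p) (sym (*-suc p M))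
    off-multiple : ∀ i → 1 ≤ i → i ≤ q → g (p * M + i) ≈ ε
    off-multiple i 1≤i i≤q with p ∣? (p * M + i)
    ... | no  _   = ≈-refl
    ... | yes p∣k = contradiction (∣⇒≤ {{>-nonZero 1≤i}} (∣m+n∣m⇒∣n p∣k (m∣m*n M))) (<⇒≱ (s≤s i≤q))
    last : g (p * M + p) ≡ f (p * suc M)
    last with p ∣? (p * M + p)
    ... | yes _   = cong f pM+p≡p[1+M]
    ... | no p∤k = contradiction (subst (p ∣_) (sym pM+p≡p[1+M]) (m∣m*n (suc M))) p∤k

  fold-update : ∀ N p x {f g} → (∀ k → k ≢ p → g k ≈ f k) → g p ≈ x ∙ f p →
                1 ≤ p → p ≤ N → fold N g ≈ x ∙ fold N f
  fold-update zero    p x g≈f gp≈xfp 1≤p p≤0 = contradiction p≤0 (<⇒≱ 1≤p)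
  fold-update (suc N) p x {f} {g} g≈f gp≈xfp 1≤p p≤N with p ≟ suc N
  ... | yes refl = begin
    fold N g ∙ g p           ≈⟨ ∙-cong (fold-cong N λ k _ k≤N → g≈f k λ { refl → 1+n≰n k≤N }) gp≈xfp ⟩
    fold N f ∙ (x ∙ f p)     ≈⟨ x∙yz≈y∙xz _ x _ ⟩
    x ∙ (fold N f ∙ f p)     ∎
  ... | no p≢1+N = begin
    fold N g ∙ g (suc N)     ≈⟨ ∙-cong (fold-update N p x g≈f gp≈xfp 1≤p (s≤s⁻¹ (≤∧≢⇒< p≤N p≢1+N))) (g≈f (suc N) (p≢1+N ∘ sym)) ⟩
    (x ∙ fold N f) ∙ f (suc N) ≈⟨ assoc x _ _ ⟩
    x ∙ (fold N f ∙ f (suc N)) ∎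

module Sumℕ = RangeFold +-0-commutativeMonoid

fold-periodic : ∀ m f → (∀ k → f (m + k) ≡ f k) → ∀ j → Sumℕ.fold (j * m) f ≡ j * Sumℕ.fold m f
fold-periodic m f f-periodic zero    = refl
fold-periodic m f f-periodic (suc j) = begin
  Sumℕ.fold (m + j * m) f                          ≡⟨ Sumℕ.fold-+ m (j * m) f ⟩
  Sumℕ.fold m f + Sumℕ.fold (j * m) (λ k → f (m + k)) ≡⟨ cong (_+_ (Sumℕ.fold m f)) (Sumℕ.fold-cong (j * m) λ k _ _ → f-periodic k) ⟩
  Sumℕ.fold m f + Sumℕ.fold (j * m) f              ≡⟨ cong (_+_ (Sumℕ.fold m f)) (fold-periodic m f f-periodic j) ⟩
  Sumℕ.fold m f + j * Sumℕ.fold m f                ∎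
  where open ≡-Reasoning

term≤fold : ∀ {N k} f → 1 ≤ k → k ≤ N → f k ≤ Sumℕ.fold N f
term≤fold {zero}  f 1≤k k≤0 = contradiction k≤0 (<⇒≱ 1≤k)
term≤fold {suc N} {k} f 1≤k k≤1+N with k ≟ suc N
... | yes refl  = m≤n+m (f k) (Sumℕ.fold N f)
... | no  k≢1+N = ≤-trans (term≤fold f 1≤k (s≤s⁻¹ (≤∧≢⇒< k≤1+N k≢1+N))) (m≤m+n (Sumℕ.fold N f) (f (suc N)))

coprime-∣ʳ : ∀ {k m n} → Coprime k n → m ∣ n → Coprime k m
coprime-∣ʳ c m∣n (i∣k , i∣m) = c (i∣k , ∣-trans i∣m m∣n)

coprime-∣ˡ : ∀ {k m n} → Coprime n k → m ∣ n → Coprime m k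
coprime-∣ˡ c m∣n = Coprime.sym (coprime-∣ʳ (Coprime.sym c) m∣n)

coprime-*ʳ : ∀ {k m n} → Coprime k m → Coprime k n → Coprime k (m * n)
coprime-*ʳ ckm ckn (i∣k , i∣mn) = ckn (i∣k , coprime-divisor (coprime-∣ˡ ckm i∣k) i∣mn)

coprime-*ˡ : ∀ {k m n} → Coprime m k → Coprime n k → Coprime (m * n) k
coprime-*ˡ cmk cnk = Coprime.sym (coprime-*ʳ (Coprime.sym cmk) (Coprime.sym cnk))

coprime-+⁻¹ : ∀ {k m} → Coprime (m + k) m → Coprime k m
coprime-+⁻¹ c (i∣k , i∣m) = c (∣m∣n⇒∣m+n i∣m i∣k , i∣m)

prime⇒≢1 : ∀ {p} → Prime p → p ≢ 1
prime⇒≢1 pp p≡1 = ¬prime[1] (subst Prime p≡1 pp)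

prime⇒≥2 : ∀ {p} → Prime p → 2 ≤ p
prime⇒≥2 {p} pp = nonTrivial⇒n>1 p {{prime⇒nonTrivial pp}}

prime∤⇒coprime : ∀ {p k} → Prime p → ¬ p ∣ k → Coprime k p
prime∤⇒coprime pp p∤k (i∣k , i∣p) with prime⇒irreducible pp i∣p
... | inj₁ i≡1  = i≡1
... | inj₂ refl = contradiction i∣k p∤k

prime∣prime⇒≡ : ∀ {k p} → Prime k → Prime p → k ∣ p → k ≡ p
prime∣prime⇒≡ pk pp k∣p with prime⇒irreducible pp k∣p
... | inj₁ k≡1 = contradiction k≡1 (prime⇒≢1 pk)
... | inj₂ k≡p = k≡p

-- Euler's totient

coprimeTo : ℕ → ℕ → ℕ
coprimeTo n = Sumℕ.mask (λ k → coprime? k n) (λ _ → 1)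

φ-as-sum : ∀ n → φ n ≡ Sumℕ.fold n (coprimeTo n)
φ-as-sum n = begin
  φ n                                                       ≡⟨ Sumℕ.foldr-filter (λ k → gcd k n ≟ 1) (λ _ → 1) (range1 n) ⟩
  foldr (λ k acc → Sumℕ.mask (λ k → gcd k n ≟ 1) (λ _ → 1) k + acc) 0 (range1 n) ≡⟨ Sumℕ.foldr-range1 _ n ⟩
  Sumℕ.fold n (Sumℕ.mask (λ k → gcd k n ≟ 1) (λ _ → 1))     ≡⟨ Sumℕ.fold-cong n (λ k _ _ → Sumℕ.select-cong gcd≡1⇒coprime coprime⇒gcd≡1 (gcd k n ≟ 1) (coprime? k n)) ⟩
  Sumℕ.fold n (coprimeTo n)                                 ∎
  where open ≡-Reasoning

coprimeTo-cong : ∀ {k n k′ n′} → (Coprime k n → Coprime k′ n′) → (Coprime k′ n′ → Coprime k n) →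
                 coprimeTo n k ≡ coprimeTo n′ k′
coprimeTo-cong {k} {n} {k′} {n′} to from = Sumℕ.select-cong to from (coprime? k n) (coprime? k′ n′)

coprimeTo-coprime : ∀ {k n} → Coprime k n → coprimeTo n k ≡ 1
coprimeTo-coprime {k} {n} c with coprime? k n
... | yes _  = refl
... | no ¬c = ⊥-elim (¬c c)

coprimeTo-periodic : ∀ m k → coprimeTo m (m + k) ≡ coprimeTo m k
coprimeTo-periodic m k = coprimeTo-cong {m + k} {m} {k} {m} coprime-+⁻¹ coprime-+

φ-*-∣ : ∀ {p m} → p ∣ m → φ (p * m) ≡ p * φ m
φ-*-∣ {p} {m} p∣m = begin
  φ (p * m)                           ≡⟨ φ-as-sum (p * m) ⟩
  Sumℕ.fold (p * m) (coprimeTo (p * m)) ≡⟨ Sumℕ.fold-cong (p * m) (λ k _ _ → coprimeTo-cong {k} {p * m} {k} {m} to from) ⟩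
  Sumℕ.fold (p * m) (coprimeTo m)     ≡⟨ fold-periodic m (coprimeTo m) (coprimeTo-periodic m) p ⟩
  p * Sumℕ.fold m (coprimeTo m)       ≡⟨ cong (p *_) (φ-as-sum m) ⟨
  p * φ m                             ∎
  where
  open ≡-Reasoning
  to : ∀ {k} → Coprime k (p * m) → Coprime k m
  to c = coprime-∣ʳ c (∣n⇒∣m*n p ∣-refl)
  from : ∀ {k} → Coprime k m → Coprime k (p * m)
  from c = coprime-*ʳ (coprime-∣ʳ c p∣m) c

coprimeTo-*-split : ∀ {p m} → Prime p → ¬ p ∣ m → ∀ k →
                    coprimeTo (p * m) k + Sumℕ.mask (p ∣?_) (coprimeTo m) k ≡ coprimeTo m k
coprimeTo-*-split {p} {m} pp p∤m k with coprime? k (p * m) | coprime? k m | p ∣? k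
... | yes k⊥pm | yes _   | yes p∣k = contradiction (k⊥pm (p∣k , m∣m*n m)) (prime⇒≢1 pp)
... | yes _    | yes _   | no  _   = refl
... | yes k⊥pm | no ¬k⊥m | _       = ⊥-elim (¬k⊥m (coprime-∣ʳ k⊥pm (∣n⇒∣m*n p ∣-refl)))
... | no  _    | yes _   | yes _   = refl
... | no ¬k⊥pm | yes k⊥m | no  p∤k = ⊥-elim (¬k⊥pm (coprime-*ʳ (prime∤⇒coprime pp p∤k) k⊥m))
... | no  _    | no  _   | yes _   = refl
... | no  _    | no  _   | no  _   = refl

φ-*-∤ : ∀ {p m} → Prime p → ¬ p ∣ m → φ (p * m) ≡ (p ∸ 1) * φ m
φ-*-∤ {zero}  pp = contradiction (prime⇒≥2 pp) λ ()
φ-*-∤ {suc q} {m} pp p∤m = +-cancelʳ-≡ (φ m) (φ (p * m)) (q * φ m) (trans φ[pm]+φ[m]≡pφ[m] (+-comm (φ m) (q * φ m)))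
  where
  open ≡-Reasoning
  p : ℕ
  p = suc q
  Σ : ℕ → (ℕ → ℕ) → ℕ
  Σ = Sumℕ.fold
  coprimeTo-p* : ∀ j → coprimeTo m j ≡ coprimeTo m (p * j)
  coprimeTo-p* j = coprimeTo-cong {j} {m} {p * j} {m} (coprime-*ˡ (Coprime.sym (prime∤⇒coprime pp p∤m)))
                                  (λ c → coprime-∣ˡ c (∣n⇒∣m*n p ∣-refl))
  φ[pm]+φ[m]≡pφ[m] : φ (p * m) + φ m ≡ p * φ m
  φ[pm]+φ[m]≡pφ[m] = begin
    φ (p * m) + φ m                                                   ≡⟨ cong₂ _+_ (φ-as-sum (p * m)) (φ-as-sum m) ⟩
    Σ (p * m) (coprimeTo (p * m)) + Σ m (coprimeTo m)                 ≡⟨ cong (_+_ (Σ (p * m) (coprimeTo (p * m)))) (Sumℕ.fold-cong m λ j _ _ → coprimeTo-p* j) ⟩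
    Σ (p * m) (coprimeTo (p * m)) + Σ m (λ j → coprimeTo m (p * j))   ≡⟨ cong (_+_ (Σ (p * m) (coprimeTo (p * m)))) (Sumℕ.fold-multiples q m (coprimeTo m)) ⟨
    Σ (p * m) (coprimeTo (p * m)) + Σ (p * m) (Sumℕ.mask (p ∣?_) (coprimeTo m)) ≡⟨ Sumℕ.fold-∙ (p * m) _ _ ⟨
    Σ (p * m) (λ k → coprimeTo (p * m) k + Sumℕ.mask (p ∣?_) (coprimeTo m) k) ≡⟨ Sumℕ.fold-cong (p * m) (λ k _ _ → coprimeTo-*-split pp p∤m k) ⟩
    Σ (p * m) (coprimeTo m)                                           ≡⟨ fold-periodic m (coprimeTo m) (coprimeTo-periodic m) p ⟩
    p * Σ m (coprimeTo m)                                             ≡⟨ cong (p *_) (φ-as-sum m) ⟨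
    p * φ m                                                           ∎

φ≥1 : ∀ {m} → 1 ≤ m → 1 ≤ φ m
φ≥1 {m} 1≤m = begin
  1                           ≡⟨ coprimeTo-coprime (1-coprimeTo m) ⟨
  coprimeTo m 1               ≤⟨ term≤fold {m} (coprimeTo m) ≤-refl 1≤m ⟩
  Sumℕ.fold m (coprimeTo m)   ≡⟨ φ-as-sum m ⟨
  φ m                         ∎
  where open ≤-Reasoning

φ≥2 : ∀ {m} → 3 ≤ m → 2 ≤ φ m
φ≥2 {1} (s≤s ())
φ≥2 {2} (s≤s (s≤s ()))
φ≥2 {m@(suc (suc (suc t)))} _ = begin
  2                                     ≡⟨ cong₂ _+_ (coprimeTo-coprime (1-coprimeTo m)) (coprimeTo-coprime m-1⊥m) ⟨
  coprimeTo m 1 + coprimeTo m (2 + t)   ≤⟨ +-monoˡ-≤ _ (term≤fold {suc t} (coprimeTo m) ≤-refl (s≤s z≤n)) ⟩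
  Sumℕ.fold (2 + t) (coprimeTo m)       ≤⟨ m≤m+n _ _ ⟩
  Sumℕ.fold m (coprimeTo m)             ≡⟨ φ-as-sum m ⟨
  φ m                                   ∎
  where
  open ≤-Reasoning
  m-1⊥m : Coprime (2 + t) m
  m-1⊥m = Coprime.sym (subst (λ x → Coprime x (2 + t)) (+-comm (2 + t) 1) (coprime-+ (1-coprimeTo (2 + t))))

toℚ : ℕ → ℚ
toℚ n = + n / 1

fromℚᵘ-homo-* : ∀ p q → fromℚᵘ (p ℚᵘ.* q) ≡ fromℚᵘ p ℚ.* fromℚᵘ q
fromℚᵘ-homo-* p q = toℚᵘ-injective (begin
  toℚᵘ (fromℚᵘ (p ℚᵘ.* q))                     ≈⟨ toℚᵘ-fromℚᵘ _ ⟩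
  p ℚᵘ.* q                                     ≈⟨ *-cong (≃-sym (toℚᵘ-fromℚᵘ p)) (≃-sym (toℚᵘ-fromℚᵘ q)) ⟩
  toℚᵘ (fromℚᵘ p) ℚᵘ.* toℚᵘ (fromℚᵘ q)         ≈⟨ ≃-sym (toℚᵘ-homo-* (fromℚᵘ p) (fromℚᵘ q)) ⟩
  toℚᵘ (fromℚᵘ p ℚ.* fromℚᵘ q)                   ∎)
  where open ≃-Reasoning

toℚ-* : ∀ m n → toℚ (m * n) ≡ toℚ m ℚ.* toℚ n
toℚ-* m n = trans (cong (_/ 1) (pos-* m n)) (fromℚᵘ-homo-* (mkℚᵘ (+ m) 0) (mkℚᵘ (+ n) 0))

toℚ-injective : ∀ {m n} → toℚ m ≡ toℚ n → m ≡ n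
toℚ-injective {m} {n} eq with fromℚᵘ-injective {mkℚᵘ (+ m) 0} {mkℚᵘ (+ n) 0} eq
... | *≡* m*1≡n*1 = +-injective (trans (sym (ℤ.*-identityʳ (+ m))) (trans m*1≡n*1 (ℤ.*-identityʳ (+ n))))

toℚ-*-factor : ∀ r → toℚ (2 + r) ℚ.* factor (2 + r) ≡ toℚ r
toℚ-*-factor r = toℚᵘ-injective (begin
  toℚᵘ (toℚ (2 + r) ℚ.* factor (2 + r))           ≈⟨ toℚᵘ-homo-* (toℚ (2 + r)) (factor (2 + r)) ⟩
  toℚᵘ (toℚ (2 + r)) ℚᵘ.* toℚᵘ (factor (2 + r)) ≈⟨ *-cong (toℚᵘ-fromℚᵘ (mkℚᵘ (+ (2 + r)) 0)) toℚᵘ-factor ⟩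
  mkℚᵘ (+ (2 + r)) 0 ℚᵘ.* (ℚᵘ.1ℚᵘ ℚᵘ.- mkℚᵘ (+ 2) (suc r)) ≈⟨ *≡* (trans (identity (+ r)) (cong (λ d → + r ℤ.* + d) (sym (trans (*-identityˡ (1 ℕ.* (2 + r))) (*-identityˡ (2 + r)))))) ⟩
  mkℚᵘ (+ r) 0                                  ≈⟨ ≃-sym (toℚᵘ-fromℚᵘ _) ⟩
  toℚᵘ (toℚ r)                                  ∎)
  where
  open ≃-Reasoning
  two/[2+r] : ℚᵘ
  two/[2+r] = mkℚᵘ (+ 2) (suc r)
  toℚᵘ-factor : toℚᵘ (factor (2 + r)) ℚᵘ.≃ ℚᵘ.1ℚᵘ ℚᵘ.- two/[2+r]
  toℚᵘ-factor = begin
    toℚᵘ (1ℚ - fromℚᵘ two/[2+r])                 ≈⟨ toℚᵘ-homo-+ 1ℚ (- fromℚᵘ two/[2+r]) ⟩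
    toℚᵘ 1ℚ ℚᵘ.+ toℚᵘ (- fromℚᵘ two/[2+r])       ≈⟨ +-cong ≃-refl (≃-trans (toℚᵘ-homo‿- (fromℚᵘ two/[2+r])) (-‿cong (toℚᵘ-fromℚᵘ two/[2+r]))) ⟩
    ℚᵘ.1ℚᵘ ℚᵘ.- two/[2+r]                        ∎
  -- (2 + r) (1 - 2 / (2 + r)) = r / 1, cross-multiplied as ℚᵘ does it
  identity : ∀ x → ((+ 2 ℤ.+ x) ℤ.* (+ 1 ℤ.* (+ 2 ℤ.+ x) ℤ.+ ℤ.-[1+ 1 ] ℤ.* + 1)) ℤ.* + 1 ≡ x ℤ.* (+ 2 ℤ.+ x)
  identity = solve-∀

-- Schemmel's totient

module Prodℚ = RangeFold ℚ.*-1-commutativeMonoid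

primeFactorWeight : ℕ → ℕ → ℚ
primeFactorWeight n = Prodℚ.mask (λ p → prime? p ×-dec p ∣? n) factor

S₂-as-product : ∀ n → S₂ n ≡ toℚ n ℚ.* Prodℚ.fold n (primeFactorWeight n)
S₂-as-product n = cong (toℚ n ℚ.*_) (trans (Prodℚ.foldr-filter _ factor (range1 n)) (Prodℚ.foldr-range1 (primeFactorWeight n) n))

primeFactorWeight-cong : ∀ {a b} k → (Prime k → k ∣ a → k ∣ b) → (Prime k → k ∣ b → k ∣ a) →
                         primeFactorWeight a k ≡ primeFactorWeight b k
primeFactorWeight-cong {a} {b} k to from =
  Prodℚ.select-cong (λ (pk , k∣a) → pk , to pk k∣a) (λ (pk , k∣b) → pk , from pk k∣b)
                    (prime? k ×-dec k ∣? a) (prime? k ×-dec k ∣? b)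

primeFactorWeight-stable : ∀ {m} d → 1 ≤ m → Prodℚ.fold (m + d) (primeFactorWeight m) ≡ Prodℚ.fold m (primeFactorWeight m)
primeFactorWeight-stable {m} d 1≤m = Prodℚ.fold-stable m d (primeFactorWeight m) beyond
  where
  beyond : ∀ k → m < k → primeFactorWeight m k ≡ 1ℚ
  beyond k m<k with prime? k ×-dec k ∣? m
  ... | yes (_ , k∣m) = contradiction (∣⇒≤ {{>-nonZero 1≤m}} k∣m) (<⇒≱ m<k)
  ... | no  _         = refl

S₂-*-∣ : ∀ {p m} → p ∣ m → 1 ≤ m → S₂ (p * m) ≡ toℚ p ℚ.* S₂ m
S₂-*-∣ {zero}  0∣m 1≤m = contradiction (subst (1 ≤_) (0∣⇒≡0 0∣m) 1≤m) λ ()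
S₂-*-∣ {suc q} {m} p∣m 1≤m = begin
  S₂ (p * m)                                               ≡⟨ S₂-as-product (p * m) ⟩
  toℚ (p * m) ℚ.* Π (p * m) (w (p * m))                    ≡⟨ cong₂ ℚ._*_ (toℚ-* p m) (Prodℚ.fold-cong (p * m) λ k _ _ → primeFactorWeight-cong k to from) ⟩
  (toℚ p ℚ.* toℚ m) ℚ.* Π (m + q * m) (w m)                ≡⟨ cong ((toℚ p ℚ.* toℚ m) ℚ.*_) (primeFactorWeight-stable (q * m) 1≤m) ⟩
  (toℚ p ℚ.* toℚ m) ℚ.* Π m (w m)                          ≡⟨ ℚ.*-assoc (toℚ p) (toℚ m) _ ⟩
  toℚ p ℚ.* (toℚ m ℚ.* Π m (w m))                          ≡⟨ cong (toℚ p ℚ.*_) (S₂-as-product m) ⟨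
  toℚ p ℚ.* S₂ m                                           ∎
  where
  open ≡-Reasoning
  p : ℕ
  p = suc q
  Π : ℕ → (ℕ → ℚ) → ℚ
  Π = Prodℚ.fold
  w : ℕ → ℕ → ℚ
  w = primeFactorWeight
  to : ∀ {k} → Prime k → k ∣ p * m → k ∣ m
  to pk k∣pm with euclidsLemma p m pk k∣pm
  ... | inj₁ k∣p = ∣-trans k∣p p∣m
  ... | inj₂ k∣m = k∣m
  from : ∀ {k} → Prime k → k ∣ m → k ∣ p * m
  from _ = ∣n⇒∣m*n p

S₂-*-∤ : ∀ {p m} → Prime p → ¬ p ∣ m → 1 ≤ m → S₂ (p * m) ≡ toℚ (p ∸ 2) ℚ.* S₂ m
S₂-*-∤ {0} pp = contradiction (prime⇒≥2 pp) λ ()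
S₂-*-∤ {1} pp = contradiction (prime⇒≥2 pp) λ { (s≤s ()) }
S₂-*-∤ {suc (suc r)} {m} pp p∤m 1≤m = begin
  S₂ (p * m)                                               ≡⟨ S₂-as-product (p * m) ⟩
  toℚ (p * m) ℚ.* Π (p * m) (w (p * m))                    ≡⟨ cong₂ ℚ._*_ (toℚ-* p m) (Prodℚ.fold-update (p * m) p (factor p) away-from-p at-p (s≤s z≤n) (m≤m*n p m {{>-nonZero 1≤m}})) ⟩
  (toℚ p ℚ.* toℚ m) ℚ.* (factor p ℚ.* Π (m + suc r * m) (w m)) ≡⟨ cong (λ x → (toℚ p ℚ.* toℚ m) ℚ.* (factor p ℚ.* x)) (primeFactorWeight-stable (suc r * m) 1≤m) ⟩
  (toℚ p ℚ.* toℚ m) ℚ.* (factor p ℚ.* Π m (w m))           ≡⟨ ℚ-*-interchange (toℚ p) (toℚ m) (factor p) _ ⟩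
  (toℚ p ℚ.* factor p) ℚ.* (toℚ m ℚ.* Π m (w m))           ≡⟨ cong₂ ℚ._*_ (toℚ-*-factor r) (sym (S₂-as-product m)) ⟩
  toℚ r ℚ.* S₂ m                                           ∎
  where
  open ≡-Reasoning
  p : ℕ
  p = suc (suc r)
  Π : ℕ → (ℕ → ℚ) → ℚ
  Π = Prodℚ.fold
  w : ℕ → ℕ → ℚ
  w = primeFactorWeight
  away-from-p : ∀ k → k ≢ p → w (p * m) k ≡ w m k
  away-from-p k k≢p = primeFactorWeight-cong k to (λ _ → ∣n⇒∣m*n p)
    where
    to : Prime k → k ∣ p * m → k ∣ m
    to pk k∣pm with euclidsLemma p m pk k∣pm
    ... | inj₁ k∣p = contradiction (prime∣prime⇒≡ pk pp k∣p) k≢p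
    ... | inj₂ k∣m = k∣m
  at-p : w (p * m) p ≡ factor p ℚ.* w m p
  at-p with prime? p ×-dec p ∣? (p * m) | prime? p ×-dec p ∣? m
  ... | yes _     | no _          = sym (ℚ.*-identityʳ (factor p))
  ... | _         | yes (_ , p∣m) = contradiction p∣m p∤m
  ... | no ¬p∣pm | _             = contradiction (pp , m∣m*n m) ¬p∣pm

-- The gap φ - S₂

record Gap (n g : ℕ) : Set where
  constructor mkGap
  field
    s       : ℕ
    S₂≡s    : S₂ n ≡ toℚ s
    s+g≡φ   : s + g ≡ φ n

gap-unique : ∀ {n g g′} → Gap n g → Gap n g′ → g ≡ g′
gap-unique (mkGap s S₂≡s s+g≡φ) (mkGap s′ S₂≡s′ s′+g′≡φ) with toℚ-injective {s} {s′} (trans (sym S₂≡s) S₂≡s′)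
... | refl = +-cancelˡ-≡ s _ _ (trans s+g≡φ (sym s′+g′≡φ))

gap[1] : Gap 1 0
gap[1] = mkGap 1 refl refl

gap-*-∣ : ∀ {p m g} → p ∣ m → 1 ≤ m → Gap m g → Gap (p * m) (p * g)
gap-*-∣ {p} {m} {g} p∣m 1≤m (mkGap s S₂≡s s+g≡φ) = mkGap (p * s) S₂[pm]≡ps ps+pg≡φ[pm]
  where
  open ≡-Reasoning
  S₂[pm]≡ps : S₂ (p * m) ≡ toℚ (p * s)
  S₂[pm]≡ps = begin
    S₂ (p * m)        ≡⟨ S₂-*-∣ p∣m 1≤m ⟩
    toℚ p ℚ.* S₂ m    ≡⟨ cong (toℚ p ℚ.*_) S₂≡s ⟩
    toℚ p ℚ.* toℚ s   ≡⟨ toℚ-* p s ⟨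
    toℚ (p * s)       ∎
  ps+pg≡φ[pm] : p * s + p * g ≡ φ (p * m)
  ps+pg≡φ[pm] = begin
    p * s + p * g     ≡⟨ *-distribˡ-+ p s g ⟨
    p * (s + g)       ≡⟨ cong (p *_) s+g≡φ ⟩
    p * φ m           ≡⟨ φ-*-∣ p∣m ⟨
    φ (p * m)         ∎

*-∸2-+ : ∀ p x → 2 ≤ p → (p ∸ 2) * x + x ≡ (p ∸ 1) * x
*-∸2-+ 1             x (s≤s ())
*-∸2-+ (suc (suc r)) x _ = +-comm (r * x) x

gap-*-∤ : ∀ {p m g} → Prime p → ¬ p ∣ m → 1 ≤ m → Gap m g → Gap (p * m) ((p ∸ 2) * g + φ m)
gap-*-∤ {p} {m} {g} pp p∤m 1≤m (mkGap s S₂≡s s+g≡φ) = mkGap (r * s) S₂[pm]≡rs rs+g′≡φ[pm]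
  where
  open ≡-Reasoning
  r : ℕ
  r = p ∸ 2
  S₂[pm]≡rs : S₂ (p * m) ≡ toℚ (r * s)
  S₂[pm]≡rs = begin
    S₂ (p * m)        ≡⟨ S₂-*-∤ pp p∤m 1≤m ⟩
    toℚ r ℚ.* S₂ m    ≡⟨ cong (toℚ r ℚ.*_) S₂≡s ⟩
    toℚ r ℚ.* toℚ s   ≡⟨ toℚ-* r s ⟨
    toℚ (r * s)       ∎
  rs+g′≡φ[pm] : r * s + (r * g + φ m) ≡ φ (p * m)
  rs+g′≡φ[pm] = begin
    r * s + (r * g + φ m) ≡⟨ +-assoc (r * s) (r * g) (φ m) ⟨
    (r * s + r * g) + φ m ≡⟨ cong (_+ φ m) (*-distribˡ-+ r s g) ⟨
    r * (s + g) + φ m     ≡⟨ cong (λ x → r * x + φ m) s+g≡φ ⟩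
    r * φ m + φ m         ≡⟨ *-∸2-+ p (φ m) (prime⇒≥2 pp) ⟩
    (p ∸ 1) * φ m         ≡⟨ φ-*-∤ pp p∤m ⟨
    φ (p * m)             ∎

gap-prime : ∀ {p} → Prime p → Gap p 1
gap-prime {p} pp = subst₂ Gap (*-identityʳ p) (cong (_+ 1) (*-zeroʳ (p ∸ 2))) (gap-*-∤ pp p∤1 ≤-refl gap[1])
  where
  p∤1 : ¬ p ∣ 1
  p∤1 p∣1 = prime⇒≢1 pp (∣1⇒≡1 p∣1)

gap-product : ∀ {ps} → All Prime ps → ∃[ g ] Gap (product ps) g
gap-product [] = 0 , gap[1]
gap-product {p ∷ ps} (pp ∷ pps) with gap-product pps | p ∣? product ps
... | g , G | yes p∣m = p * g , gap-*-∣ p∣m (productOfPrimes≥1 pps) G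
... | g , G | no  p∤m = _ , gap-*-∤ pp p∤m (productOfPrimes≥1 pps) G

gap-*-∤≢1 : ∀ {p m g} → Prime p → ¬ p ∣ m → 2 ≤ m → Gap m g → (p ∸ 2) * g + φ m ≢ 1
gap-*-∤≢1 {p} {m} {g} pp p∤m 2≤m G eq with m ≤? 2
... | no m≰2 = contradiction (≤-trans (φ≥2 {m} (≰⇒> m≰2)) (subst (φ m ≤_) eq (m≤n+m (φ m) _))) λ { (s≤s ()) }
... | yes m≤2 with ≤-antisym m≤2 2≤m
...   | refl with gap-unique G (gap-prime prime[2])
...     | refl = p∤m (subst (p ∣_) p≡2 ∣-refl)
  where
  p≡2 : p ≡ 2
  p≡2 = ≤-antisym (m∸n≡0⇒m≤n {p} {2} (trans (sym (*-identityʳ (p ∸ 2))) (+-cancelʳ-≡ 1 _ 0 eq))) (prime⇒≥2 pp)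

gap≢1 : ∀ {p m g} → Prime p → 2 ≤ m → Gap m g → ¬ Gap (p * m) 1
gap≢1 {p} {m} {g} pp 2≤m G G₁ with p ∣? m
... | yes p∣m = prime⇒≢1 pp (m*n≡1⇒m≡1 p g (gap-unique (gap-*-∣ p∣m (<⇒≤ 2≤m) G) G₁))
... | no  p∤m = gap-*-∤≢1 pp p∤m 2≤m G (gap-unique (gap-*-∤ pp p∤m (<⇒≤ 2≤m) G) G₁)

gap1⇒prime : ∀ {n} → 2 ≤ n → Gap n 1 → Prime n
gap1⇒prime {n} 2≤n G₁ = fromFactorisation (factorise n {{>-nonZero (<⇒≤ 2≤n)}})
  where
  fromFactorisation : PrimeFactorisation n → Prime n
  fromFactorisation record { factors = [] ; isFactorisation = n≡1 } =
    contradiction (subst (2 ≤_) n≡1 2≤n) λ { (s≤s ()) }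
  fromFactorisation record { factors = p ∷ [] ; isFactorisation = n≡p*1 ; factorsPrime = pp ∷ [] } =
    subst Prime (sym (trans n≡p*1 (*-identityʳ p))) pp
  fromFactorisation record { factors = p ∷ q ∷ qs ; isFactorisation = n≡p*m ; factorsPrime = pp ∷ qsp@(qp ∷ qps) } =
    ⊥-elim (gap≢1 pp (*-mono-≤ (prime⇒≥2 qp) (productOfPrimes≥1 qps)) (proj₂ (gap-product qsp)) (subst (λ x → Gap x 1) n≡p*m G₁))

S₂≡φ∸1⇔gap1 : ∀ {n} → 1 ≤ n → (S₂ n ≡ toℚ (φ n ∸ 1)) ⇔ Gap n 1
S₂≡φ∸1⇔gap1 {n} 1≤n = mk⇔
  (λ S₂≡φ∸1 → mkGap (φ n ∸ 1) S₂≡φ∸1 (m∸n+n≡m (φ≥1 1≤n)))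
  (λ (mkGap s S₂≡s s+1≡φ) → trans S₂≡s (cong toℚ (trans (sym (m+n∸n≡m s 1)) (cong (_∸ 1) s+1≡φ))))

lemma2p1 : (n : ℕ) → 2 ≤ n → (S₂ n ≡ (+ (φ n ∸ 1)) / 1) ⇔ Prime n
lemma2p1 n 2≤n = ⇔-trans (S₂≡φ∸1⇔gap1 (<⇒≤ 2≤n)) (mk⇔ (gap1⇒prime 2≤n) gap-prime)
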